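{- For any tree $T$ and valuation $V$, we have $[\![(\phi>k)]\!]^T_V = [\![\mu x.\,(C^\phi_k\wedge r)\vee\langle\uparrow\rangle x\vee\langle\leftarrow\rangle x]\!]^T_V$.
   Context: Trees are finite binary (first-child/next-sibling) trees: $\langle\downarrow\rangle\phi$ holds where the first child satisfies $\phi$, $\langle\rightarrow\rangle\phi$ where the next sibling does, $\langle\uparrow\rangle,\langle\leftarrow\rangle$ are the converses. $(\phi>k)$ denotes all nodes if more than $k$ nodes of $T$ satisfy $\phi$, else $\emptyset$ ($k$ in binary); $\mu$ is the least fixed point. The root is $r=\neg\langle\uparrow\rangle\top\wedge\neg\langle\leftarrow\rangle\top$. Formulas $C^\phi_i$: $C^\phi_0=\mu x.\,\phi\vee\langle\downarrow\rangle x\vee\langle\rightarrow\rangle x$; $C^\phi_1=\mu x.\,\big(\phi\wedge(\langle\downarrow\rangle C^\phi_0\vee\langle\rightarrow\rangle C^\phi_0)\big)\vee\big(\neg\phi\wedge\langle\downarrow\rangle C^\phi_0\wedge\langle\rightarrow\rangle C^\phi_0\big)\vee\langle\downarrow\rangle x\vee\langle\rightarrow\rangle x$; and for $i>1$, $C^\phi_i=\mu x.\,\Big(\phi\wedge\big(\langle\downarrow\rangle C^\phi_{i-1}\vee\langle\rightarrow\rangle C^\phi_{i-1}\vee\bigvee_{k_1+k_2=i-2}\langle\downarrow\rangle C^\phi_{k_1}\wedge\langle\rightarrow\rangle C^\phi_{k_2}\big)\Big)\vee\Big(\neg\phi\wedge\bigvee_{k_1+k_2=i-1}\langle\downarrow\rangle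 C^\phi_{k_1}\wedge\langle\rightarrow\rangle C^\phi_{k_2}\Big)\vee\langle\downarrow\rangle x\vee\langle\rightarrow\rangle x$. Intended meaning: at the root, $C^\phi_k$ counts at least $k+1$ nodes satisfying $\phi$. -}

module Defs where

open import Data.Nat using (ℕ; zero; suc; _+_; _∸_; _<ᵇ_)
open import Data.Bool using (Bool; true; false; _∧_; _∨_; not)
open import Data.List using (List; []; _∷_; _++_; map; reverse; length; filterᵇ; upTo; foldr)

-- Finite binary (first-child / next-sibling) trees.
-- `leaf` is the absent tree; `node fc ns` is a node whose first-child
-- subtree is fc and whose next-sibling subtree is ns.

data Tree : Set where
  leaf : Tree
  node : Tree → Tree → Tree

-- Steps: dn = go to first child, rt = go to next sibling.
data Dir : Set where
  dn rt : Dir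

-- A node address is the path from the top node, stored REVERSED
-- (head = last step taken).  So  dn ∷ p  is the first child of p,
-- rt ∷ p  is the next sibling of p.
Addr : Set
Addr = List Dir

validF : Tree → List Dir → Bool
validF leaf       _        = false
validF (node l r) []       = true
validF (node l r) (dn ∷ p) = validF l p
validF (node l r) (rt ∷ p) = validF r p

valid : Tree → Addr → Bool
valid T p = validF T (reverse p)

nodesF : Tree → List (List Dir)
nodesF leaf       = []
nodesF (node l r) = [] ∷ (map (dn ∷_) (nodesF l) ++ map (rt ∷_) (nodesF r))

nodes : Tree → List Addr
nodes T = map reverse (nodesF T)

size : Tree → ℕ
size T = length (nodes T)

count : Tree → (Addr → Bool) → ℕ
count T S = length (filterᵇ S (nodes T))

-- Formulas (de Bruijn variables: `var 0` is bound by the nearest μ)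

data Prog : Set where
  ↓ ⇾ ↑ ← : Prog

data Form : Set where
  ⊤'     : Form
  var    : ℕ → Form
  ¬'_    : Form → Form
  _∧'_   : Form → Form → Form
  _∨'_   : Form → Form → Form
  ⟨_⟩_   : Prog → Form → Form
  μ'     : Form → Form
  _>'_   : Form → ℕ → Form

infixr 6 _∧'_
infixr 5 _∨'_
infix  8 ¬'_ ⟨_⟩_

⊥' : Form
⊥' = ¬' ⊤'

shift : ℕ → Form → Form
shift c ⊤'         = ⊤'
shift c (var i)    with i <ᵇ c
... | true  = var i
... | false = var (suc i)
shift c (¬' φ)     = ¬' shift c φ
shift c (φ ∧' ψ)   = shift c φ ∧' shift c ψ
shift c (φ ∨' ψ)   = shift c φ ∨' shift c ψ
shift c (⟨ a ⟩ φ)  = ⟨ a ⟩ shift c φ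
shift c (μ' φ)     = μ' (shift (suc c) φ)
shift c (φ >' k)   = shift c φ >' k

wk : Form → Form
wk = shift 0

-- Semantics on a tree T.  Sets of nodes are Boolean predicates on
-- addresses; every denotation is contained in the node set of T.

Val : Set
Val = ℕ → Addr → Bool

ext : (Addr → Bool) → Val → Val
ext S V zero    = S
ext S V (suc i) = V i

iter : {A : Set} → ℕ → (A → A) → A → A
iter zero    f a = a
iter (suc n) f a = f (iter n f a)

-- Least fixed point on the finite lattice of node sets of T:
-- Kleene iteration from ∅, run (number of nodes of T) times.
⟦_⟧ : Tree → Form → Val → Addr → Bool
⟦ T ⟧ ⊤'           V p = valid T p
⟦ T ⟧ (var i)      V p = V i p ∧ valid T p
⟦ T ⟧ (¬' φ)       V p = valid T p ∧ not (⟦ T ⟧ φ V p)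
⟦ T ⟧ (φ ∧' ψ)     V p = ⟦ T ⟧ φ V p ∧ ⟦ T ⟧ ψ V p
⟦ T ⟧ (φ ∨' ψ)     V p = ⟦ T ⟧ φ V p ∨ ⟦ T ⟧ ψ V p
⟦ T ⟧ (⟨ ↓ ⟩ φ)    V p = valid T (dn ∷ p) ∧ ⟦ T ⟧ φ V (dn ∷ p)
⟦ T ⟧ (⟨ ⇾ ⟩ φ)    V p = valid T (rt ∷ p) ∧ ⟦ T ⟧ φ V (rt ∷ p)
⟦ T ⟧ (⟨ ↑ ⟩ φ)    V []       = false
⟦ T ⟧ (⟨ ↑ ⟩ φ)    V (dn ∷ q) = valid T (dn ∷ q) ∧ ⟦ T ⟧ φ V q
⟦ T ⟧ (⟨ ↑ ⟩ φ)    V (rt ∷ q) = false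
⟦ T ⟧ (⟨ ← ⟩ φ)    V []       = false
⟦ T ⟧ (⟨ ← ⟩ φ)    V (dn ∷ q) = false
⟦ T ⟧ (⟨ ← ⟩ φ)    V (rt ∷ q) = valid T (rt ∷ q) ∧ ⟦ T ⟧ φ V q
⟦ T ⟧ (μ' φ)       V p = iter (size T) (λ S → ⟦ T ⟧ φ (ext S V)) (λ _ → false) p
⟦ T ⟧ (φ >' k)     V p = valid T p ∧ (k <ᵇ count T (⟦ T ⟧ φ V))

root : Form
root = ¬' ⟨ ↑ ⟩ ⊤' ∧' ¬' ⟨ ← ⟩ ⊤'

look : List Form → ℕ → Form
look []       _       = ⊥'
look (c ∷ cs) zero    = c
look (c ∷ cs) (suc n) = look cs n

x₀ : Form
x₀ = var 0

-- ⋁_{k1+k2=m} ⟨↓⟩C_{k1} ∧ ⟨→⟩C_{k2}  (cs = [C_0, C_1, ...])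
pairs : List Form → ℕ → Form
pairs cs m = foldr (λ k1 acc → (⟨ ↓ ⟩ look cs k1 ∧' ⟨ ⇾ ⟩ look cs (m ∸ k1)) ∨' acc) ⊥' (upTo (suc m))

-- Cstep φ [C_0,…,C_{i-1}] i = C^φ_i
Cstep : Form → List Form → ℕ → Form
Cstep φ cs zero =
  μ' (wk φ ∨' ⟨ ↓ ⟩ x₀ ∨' ⟨ ⇾ ⟩ x₀)
Cstep φ cs (suc zero) =
  μ' ((wk φ ∧' (⟨ ↓ ⟩ wk c0 ∨' ⟨ ⇾ ⟩ wk c0))
      ∨' (¬' wk φ ∧' ⟨ ↓ ⟩ wk c0 ∧' ⟨ ⇾ ⟩ wk c0)
      ∨' ⟨ ↓ ⟩ x₀ ∨' ⟨ ⇾ ⟩ x₀)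
  where c0 = look cs 0
Cstep φ cs (suc (suc i)) =
  μ' ((wk φ ∧' (⟨ ↓ ⟩ wk (look cs (suc i)) ∨' ⟨ ⇾ ⟩ wk (look cs (suc i)) ∨' wk (pairs cs i)))
      ∨' (¬' wk φ ∧' wk (pairs cs (suc i)))
      ∨' ⟨ ↓ ⟩ x₀ ∨' ⟨ ⇾ ⟩ x₀)

Clist : Form → ℕ → List Form
Clist φ zero    = []
Clist φ (suc n) = Clist φ n ++ (Cstep φ (Clist φ n) n ∷ [])

C : Form → ℕ → Form
C φ k = Cstep φ (Clist φ k) k

module Submission where

-- Write  below q  for the number of φ-nodes in the subtree rooted at q (q itself,
-- its first-child subtree and its next-sibling subtree).  The argument has three parts.
--  * Downward fixpoints.  μx. β ∨ ⟨↓⟩x ∨ ⟨→⟩x holds at q iff β holds somewhere in the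
--    subtree of q (lfp-down); the Kleene iteration needs at most |T| rounds.
--  * Counting.  If β holds at every node exactly when the local recurrence  localC j
--    says so, then "β somewhere below q" is "j < below q" (somewhere-count).  The local
--    recurrence is justified by pure arithmetic: a count of the form e + a + b exceeds j
--    iff the node itself, one child, or a split j = k₁ + k₂ between the children does
--    (local-count, resting on split-eq).  By strong induction on i the formula C^φ_i
--    satisfies this recurrence, so  C^φ_i  holds at q iff  i < below q  (Counting.counts).
--  * Upward fixpoints.  μx. (ψ ∧ r) ∨ ⟨↑⟩x ∨ ⟨←⟩x holds at a node iff ψ holds at the
--    root, since every node is reached from the root by ↓/→ steps (lfp-up).
-- At the root  below [] = count T ⟦φ⟧, so both sides of the theorem equal  k < count T ⟦φ⟧.

open import Defs
open import Data.Nat using (ℕ; zero; suc; _+_; _∸_; _<ᵇ_; _≤_; _<_; z≤n; s≤s; _<?_)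
open import Data.Nat.Properties
open import Data.Nat.Induction using (<-rec)
open import Data.Bool using (Bool; true; false; _∧_; _∨_; not; if_then_else_; T?)
open import Data.Bool.Properties
  using (∨-assoc; ∨-comm; ∨-identityʳ; ∨-zeroʳ; ∧-identityʳ; ∧-zeroʳ; ∧-inverseʳ; ∧-conicalˡ; ∧-conicalʳ; T-≡; ⇔→≡)
open import Data.List using (List; []; _∷_; _++_; map; reverse; length; filterᵇ; upTo; foldr; _ʳ++_)
open import Data.List.Properties using (map-++; map-∘; length-++; filter-++; unfold-reverse; length-reverse)
open import Data.List.Membership.Propositional using (_∈_)
open import Data.List.Membership.Propositional.Properties using (∈-upTo⁺; ∈-upTo⁻)
open import Data.List.Relation.Unary.Any using (here; there)
open import Data.List.Relation.Unary.All using (All; []; _∷_)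
open import Data.List.Relation.Unary.All.Properties using (all-upTo)
open import Data.Product using (Σ; _×_; _,_)
open import Data.Sum using (_⊎_; inj₁; inj₂)
open import Data.Empty using (⊥-elim)
open import Function using (_∘_)
open import Function.Bundles using (mk⇔; Equivalence)
open import Relation.Nullary using (yes; no)
open import Relation.Binary.PropositionalEquality

∨-true⁻ : ∀ {x y} → x ∨ y ≡ true → x ≡ true ⊎ y ≡ true
∨-true⁻ {true}  _ = inj₁ refl
∨-true⁻ {false} e = inj₂ e

∨-true⁺ˡ : ∀ {x} y → x ≡ true → x ∨ y ≡ true
∨-true⁺ˡ y refl = refl

∨-true⁺ʳ : ∀ x {y} → y ≡ true → x ∨ y ≡ true
∨-true⁺ʳ x refl = ∨-zeroʳ x

false-by : ∀ {x y} → (x ≡ true → y ≡ true) → y ≡ false → x ≡ false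
false-by {false} _ _ = refl
false-by {true}  h e with () ← trans (sym (h refl)) e

∨-absorb : ∀ x y → (y ≡ true → x ≡ true) → x ∨ y ≡ x
∨-absorb true  y h = refl
∨-absorb false y h = false-by h refl

∨-rotate : ∀ x y z → x ∨ (y ∨ z) ≡ y ∨ (z ∨ x)
∨-rotate x y z = trans (∨-comm x (y ∨ z)) (∨-assoc y z x)

<ᵇ-sound : ∀ {m n} → (m <ᵇ n) ≡ true → m < n
<ᵇ-sound {m} {n} e = <ᵇ⇒< m n (Equivalence.from T-≡ e)

<ᵇ-complete : ∀ {m n} → m < n → (m <ᵇ n) ≡ true
<ᵇ-complete h = Equivalence.to T-≡ (<⇒<ᵇ h)

bit : Bool → ℕ
bit true  = 1
bit false = 0

countAt : (Addr → Bool) → Tree → Addr → ℕ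
countAt S leaf       p = 0
countAt S (node l r) p = bit (S p) + (countAt S l (dn ∷ p) + countAt S r (rt ∷ p))

nsize : Tree → ℕ
nsize leaf       = 0
nsize (node l r) = suc (nsize l + nsize r)

-- Addresses of the nodes of t when t hangs at address p; nodes T = placed T [].
placed : Tree → Addr → List Addr
placed t p = map (_ʳ++ p) (nodesF t)

placed-node : ∀ l r p → placed (node l r) p ≡ p ∷ (placed l (dn ∷ p) ++ placed r (rt ∷ p))
placed-node l r p = cong (p ∷_) (begin
  map (_ʳ++ p) (map (dn ∷_) (nodesF l) ++ map (rt ∷_) (nodesF r))
    ≡⟨ map-++ (_ʳ++ p) (map (dn ∷_) (nodesF l)) (map (rt ∷_) (nodesF r)) ⟩
  map (_ʳ++ p) (map (dn ∷_) (nodesF l)) ++ map (_ʳ++ p) (map (rt ∷_) (nodesF r))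
    ≡⟨ sym (cong₂ _++_ (map-∘ (nodesF l)) (map-∘ (nodesF r))) ⟩
  placed l (dn ∷ p) ++ placed r (rt ∷ p) ∎)
  where open ≡-Reasoning

filter-∷ : ∀ (S : Addr → Bool) p xs → length (filterᵇ S (p ∷ xs)) ≡ bit (S p) + length (filterᵇ S xs)
filter-∷ S p xs with S p
... | true  = refl
... | false = refl

filter-++-length : ∀ (S : Addr → Bool) xs ys →
  length (filterᵇ S (xs ++ ys)) ≡ length (filterᵇ S xs) + length (filterᵇ S ys)
filter-++-length S xs ys = trans (cong length (filter-++ (T? ∘ S) xs ys)) (length-++ (filterᵇ S xs))

count-placed : ∀ (S : Addr → Bool) t p → length (filterᵇ S (placed t p)) ≡ countAt S t p
count-placed S leaf       p = refl
count-placed S (node l r) p = begin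
  length (filterᵇ S (placed (node l r) p))
    ≡⟨ cong (length ∘ filterᵇ S) (placed-node l r p) ⟩
  length (filterᵇ S (p ∷ (placed l (dn ∷ p) ++ placed r (rt ∷ p))))
    ≡⟨ filter-∷ S p (placed l (dn ∷ p) ++ placed r (rt ∷ p)) ⟩
  bit (S p) + length (filterᵇ S (placed l (dn ∷ p) ++ placed r (rt ∷ p)))
    ≡⟨ cong (bit (S p) +_) (filter-++-length S (placed l (dn ∷ p)) (placed r (rt ∷ p))) ⟩
  bit (S p) + (length (filterᵇ S (placed l (dn ∷ p))) + length (filterᵇ S (placed r (rt ∷ p))))
    ≡⟨ cong (bit (S p) +_) (cong₂ _+_ (count-placed S l (dn ∷ p)) (count-placed S r (rt ∷ p))) ⟩
  countAt S (node l r) p ∎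
  where open ≡-Reasoning

count≡countAt : ∀ T (S : Addr → Bool) → count T S ≡ countAt S T []
count≡countAt T S = count-placed S T []

countAt-cong : ∀ {S S'} → S ≗ S' → ∀ t p → countAt S t p ≡ countAt S' t p
countAt-cong h leaf       p = refl
countAt-cong h (node l r) p =
  cong₂ (λ x y → bit x + y) (h p) (cong₂ _+_ (countAt-cong h l (dn ∷ p)) (countAt-cong h r (rt ∷ p)))

count-cong : ∀ T {S S'} → S ≗ S' → count T S ≡ count T S'
count-cong T {S} {S'} h = trans (count≡countAt T S) (trans (countAt-cong h T []) (sym (count≡countAt T S')))

length-placed : ∀ t p → length (placed t p) ≡ nsize t
length-placed leaf       p = refl
length-placed (node l r) p = begin
  length (placed (node l r) p)                         ≡⟨ cong length (placed-node l r p) ⟩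
  suc (length (placed l (dn ∷ p) ++ placed r (rt ∷ p))) ≡⟨ cong suc (length-++ (placed l (dn ∷ p))) ⟩
  suc (length (placed l (dn ∷ p)) + length (placed r (rt ∷ p)))
    ≡⟨ cong suc (cong₂ _+_ (length-placed l (dn ∷ p)) (length-placed r (rt ∷ p))) ⟩
  nsize (node l r) ∎
  where open ≡-Reasoning

size≡nsize : ∀ T → size T ≡ nsize T
size≡nsize T = length-placed T []

isNode : Tree → Bool
isNode leaf       = false
isNode (node _ _) = true

child : Dir → Tree → Tree
child _  leaf       = leaf
child dn (node l r) = l
child rt (node l r) = r

subF : Tree → List Dir → Tree
subF t          []       = t
subF leaf       (_ ∷ _)  = leaf
subF (node l r) (dn ∷ w) = subF l w
subF (node l r) (rt ∷ w) = subF r w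

validF≡isNode : ∀ t w → validF t w ≡ isNode (subF t w)
validF≡isNode leaf       []       = refl
validF≡isNode leaf       (_ ∷ _)  = refl
validF≡isNode (node l r) []       = refl
validF≡isNode (node l r) (dn ∷ w) = validF≡isNode l w
validF≡isNode (node l r) (rt ∷ w) = validF≡isNode r w

subF-snoc : ∀ t w d → subF t (w ++ d ∷ []) ≡ child d (subF t w)
subF-snoc leaf       []       d  = refl
subF-snoc leaf       (_ ∷ _)  d  = refl
subF-snoc (node l r) []       dn = refl
subF-snoc (node l r) []       rt = refl
subF-snoc (node l r) (dn ∷ w) d  = subF-snoc l w d
subF-snoc (node l r) (rt ∷ w) d  = subF-snoc r w d

validF-depth : ∀ t w → validF t w ≡ true → length w < nsize t
validF-depth (node l r) []       _ = s≤s z≤n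
validF-depth (node l r) (dn ∷ w) v = s≤s (≤-trans (validF-depth l w v) (m≤m+n (nsize l) (nsize r)))
validF-depth (node l r) (rt ∷ w) v = s≤s (≤-trans (validF-depth r w v) (m≤n+m (nsize r) (nsize l)))

subF-size : ∀ t w → nsize (subF t w) ≤ nsize t
subF-size t          []       = ≤-refl
subF-size leaf       (_ ∷ _)  = z≤n
subF-size (node l r) (dn ∷ w) = ≤-trans (subF-size l w) (≤-trans (m≤m+n (nsize l) (nsize r)) (n≤1+n _))
subF-size (node l r) (rt ∷ w) = ≤-trans (subF-size r w) (≤-trans (m≤n+m (nsize r) (nsize l)) (n≤1+n _))

subAt : Tree → Addr → Tree
subAt T p = subF T (reverse p)

subAt-∷ : ∀ T d p → subAt T (d ∷ p) ≡ child d (subAt T p)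
subAt-∷ T d p = trans (cong (subF T) (unfold-reverse d p)) (subF-snoc T (reverse p) d)

valid≡isNode : ∀ T p → valid T p ≡ isNode (subAt T p)
valid≡isNode T p = validF≡isNode T (reverse p)

valid-parent : ∀ T d p → valid T (d ∷ p) ≡ true → valid T p ≡ true
valid-parent T d p v = trans (valid≡isNode T p) (has-child d (subAt T p) child-node)
  where
  child-node : isNode (child d (subAt T p)) ≡ true
  child-node = trans (sym (cong isNode (subAt-∷ T d p))) (trans (sym (valid≡isNode T (d ∷ p))) v)
  has-child : ∀ d t → isNode (child d t) ≡ true → isNode t ≡ true
  has-child d (node _ _) _ = refl

valid-depth : ∀ T p → valid T p ≡ true → length p < size T
valid-depth T p v = subst₂ _<_ (length-reverse p) (sym (size≡nsize T)) (validF-depth T (reverse p) v)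

subtree-size : ∀ T p → nsize (subAt T p) ≤ size T
subtree-size T p = subst (nsize (subAt T p) ≤_) (sym (size≡nsize T)) (subF-size T (reverse p))

_≈V_ : Val → Val → Set
V ≈V W = ∀ i → V i ≗ W i

∅ : Addr → Bool
∅ _ = false

iter-cong : ∀ {F G : (Addr → Bool) → Addr → Bool} →
  (∀ {S S'} → S ≗ S' → F S ≗ G S') → ∀ n → iter n F ∅ ≗ iter n G ∅
iter-cong h zero    q = refl
iter-cong h (suc n) q = h (iter-cong h n) q

ext-cong : ∀ {S S' V W} → S ≗ S' → V ≈V W → ext S V ≈V ext S' W
ext-cong e h zero    = e
ext-cong e h (suc i) = h i

sem-cong : ∀ T ψ {V W} → V ≈V W → ⟦ T ⟧ ψ V ≗ ⟦ T ⟧ ψ W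
sem-cong T ⊤'        h p        = refl
sem-cong T (var i)   h p        = cong (_∧ valid T p) (h i p)
sem-cong T (¬' ψ)    h p        = cong (λ b → valid T p ∧ not b) (sem-cong T ψ h p)
sem-cong T (ψ ∧' χ)  h p        = cong₂ _∧_ (sem-cong T ψ h p) (sem-cong T χ h p)
sem-cong T (ψ ∨' χ)  h p        = cong₂ _∨_ (sem-cong T ψ h p) (sem-cong T χ h p)
sem-cong T (⟨ ↓ ⟩ ψ) h p        = cong (valid T (dn ∷ p) ∧_) (sem-cong T ψ h (dn ∷ p))
sem-cong T (⟨ ⇾ ⟩ ψ) h p        = cong (valid T (rt ∷ p) ∧_) (sem-cong T ψ h (rt ∷ p))
sem-cong T (⟨ ↑ ⟩ ψ) h []       = refl
sem-cong T (⟨ ↑ ⟩ ψ) h (dn ∷ q) = cong (valid T (dn ∷ q) ∧_) (sem-cong T ψ h q)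
sem-cong T (⟨ ↑ ⟩ ψ) h (rt ∷ q) = refl
sem-cong T (⟨ ← ⟩ ψ) h []       = refl
sem-cong T (⟨ ← ⟩ ψ) h (dn ∷ q) = refl
sem-cong T (⟨ ← ⟩ ψ) h (rt ∷ q) = cong (valid T (rt ∷ q) ∧_) (sem-cong T ψ h q)
sem-cong T (μ' ψ)    h p        = iter-cong (λ e → sem-cong T ψ (ext-cong e h)) (size T) p
sem-cong T (ψ >' k)  h p        = cong (λ c → valid T p ∧ (k <ᵇ c)) (count-cong T (sem-cong T ψ h))

-- The valuation seen by a formula shifted at cutoff c: variable c is skipped.
unshift : ℕ → Val → Val
unshift c V i = if i <ᵇ c then V i else V (suc i)

unshift-ext : ∀ c {S S'} V → S ≗ S' → unshift (suc c) (ext S V) ≈V ext S' (unshift c V)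
unshift-ext c V e zero    = e
unshift-ext c V e (suc i) = λ _ → refl

sem-shift : ∀ T ψ c V → ⟦ T ⟧ (shift c ψ) V ≗ ⟦ T ⟧ ψ (unshift c V)
sem-shift T ⊤'        c V p        = refl
sem-shift T (var i)   c V p        with i <ᵇ c
... | true  = refl
... | false = refl
sem-shift T (¬' ψ)    c V p        = cong (λ b → valid T p ∧ not b) (sem-shift T ψ c V p)
sem-shift T (ψ ∧' χ)  c V p        = cong₂ _∧_ (sem-shift T ψ c V p) (sem-shift T χ c V p)
sem-shift T (ψ ∨' χ)  c V p        = cong₂ _∨_ (sem-shift T ψ c V p) (sem-shift T χ c V p)
sem-shift T (⟨ ↓ ⟩ ψ) c V p        = cong (valid T (dn ∷ p) ∧_) (sem-shift T ψ c V (dn ∷ p))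
sem-shift T (⟨ ⇾ ⟩ ψ) c V p        = cong (valid T (rt ∷ p) ∧_) (sem-shift T ψ c V (rt ∷ p))
sem-shift T (⟨ ↑ ⟩ ψ) c V []       = refl
sem-shift T (⟨ ↑ ⟩ ψ) c V (dn ∷ q) = cong (valid T (dn ∷ q) ∧_) (sem-shift T ψ c V q)
sem-shift T (⟨ ↑ ⟩ ψ) c V (rt ∷ q) = refl
sem-shift T (⟨ ← ⟩ ψ) c V []       = refl
sem-shift T (⟨ ← ⟩ ψ) c V (dn ∷ q) = refl
sem-shift T (⟨ ← ⟩ ψ) c V (rt ∷ q) = cong (valid T (rt ∷ q) ∧_) (sem-shift T ψ c V q)
sem-shift T (μ' ψ)    c V p        =
  iter-cong (λ {S} e q → trans (sem-shift T ψ (suc c) (ext S V) q) (sem-cong T ψ (unshift-ext c V e) q))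
            (size T) p
sem-shift T (ψ >' k)  c V p        = cong (λ n → valid T p ∧ (k <ᵇ n)) (count-cong T (sem-shift T ψ c V))

sem-wk : ∀ T ψ S V → ⟦ T ⟧ (wk ψ) (ext S V) ≗ ⟦ T ⟧ ψ V
sem-wk T ψ S V p = trans (sem-shift T ψ 0 (ext S V) p) (sem-cong T ψ (λ i q → refl) p)

sem-valid : ∀ T ψ V p → ⟦ T ⟧ ψ V p ≡ true → valid T p ≡ true
sem-valid T ⊤'        V p        e = e
sem-valid T (var i)   V p        e = ∧-conicalʳ _ _ e
sem-valid T (¬' ψ)    V p        e = ∧-conicalˡ _ _ e
sem-valid T (ψ ∧' χ)  V p        e = sem-valid T ψ V p (∧-conicalˡ _ _ e)
sem-valid T (ψ ∨' χ)  V p        e with ∨-true⁻ {⟦ T ⟧ ψ V p} e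
... | inj₁ x = sem-valid T ψ V p x
... | inj₂ x = sem-valid T χ V p x
sem-valid T (⟨ ↓ ⟩ ψ) V p        e = valid-parent T dn p (∧-conicalˡ _ _ e)
sem-valid T (⟨ ⇾ ⟩ ψ) V p        e = valid-parent T rt p (∧-conicalˡ _ _ e)
sem-valid T (⟨ ↑ ⟩ ψ) V (dn ∷ q) e = ∧-conicalˡ _ _ e
sem-valid T (⟨ ← ⟩ ψ) V (rt ∷ q) e = ∧-conicalˡ _ _ e
sem-valid T (μ' ψ)    V p        e = iterate (size T) p e
  where
  iterate : ∀ n q → iter n (λ S → ⟦ T ⟧ ψ (ext S V)) ∅ q ≡ true → valid T q ≡ true
  iterate (suc n) q e = sem-valid T ψ _ q e
sem-valid T (ψ >' k)  V p        e = ∧-conicalˡ _ _ e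

valid-∧ : ∀ T ψ V p → valid T p ∧ ⟦ T ⟧ ψ V p ≡ ⟦ T ⟧ ψ V p
valid-∧ T ψ V p with ⟦ T ⟧ ψ V p in eq
... | true  = trans (∧-identityʳ (valid T p)) (sem-valid T ψ V p eq)
... | false = ∧-zeroʳ (valid T p)

-- S holds at the first child or at the next sibling of q: the value of ⟨↓⟩x ∨ ⟨→⟩x.
atChild : Tree → (Addr → Bool) → Addr → Bool
atChild T S q = (valid T (dn ∷ q) ∧ (S (dn ∷ q) ∧ valid T (dn ∷ q)))
              ∨ (valid T (rt ∷ q) ∧ (S (rt ∷ q) ∧ valid T (rt ∷ q)))

somewhere : (Addr → Bool) → Tree → Addr → Bool
somewhere β leaf       q = false
somewhere β (node l r) q = β q ∨ (somewhere β l (dn ∷ q) ∨ somewhere β r (rt ∷ q))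

somewhere-guard : ∀ β t q → isNode t ∧ (somewhere β t q ∧ isNode t) ≡ somewhere β t q
somewhere-guard β leaf       q = refl
somewhere-guard β (node l r) q = ∧-identityʳ _

lfp-down : ∀ T (β : Addr → Bool) (F : (Addr → Bool) → Addr → Bool) →
  (∀ q → β q ≡ true → valid T q ≡ true) → (∀ S q → F S q ≡ β q ∨ atChild T S q) →
  ∀ q → iter (size T) F ∅ q ≡ somewhere β (subAt T q) q
lfp-down T β F β-valid unfold q = rounds (size T) q (subAt T q) refl (subtree-size T q)
  where
  rounds : ∀ n q t → subAt T q ≡ t → nsize t ≤ n → iter n F ∅ q ≡ somewhere β t q
  rounds zero    q leaf       _ _       = refl
  rounds (suc n) q leaf       e _       =
    trans (unfold (iter n F ∅) q) (cong₂ _∨_ β-outside (cong₂ _∨_ (child-outside dn) (child-outside rt)))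
    where
    β-outside : β q ≡ false
    β-outside = false-by (β-valid q) (trans (valid≡isNode T q) (cong isNode e))
    child-outside : ∀ d → valid T (d ∷ q) ∧ (iter n F ∅ (d ∷ q) ∧ valid T (d ∷ q)) ≡ false
    child-outside d = cong (_∧ (iter n F ∅ (d ∷ q) ∧ valid T (d ∷ q)))
                           (trans (valid≡isNode T (d ∷ q)) (cong isNode (trans (subAt-∷ T d q) (cong (child d) e))))
  rounds (suc n) q (node l r) e (s≤s h) =
    trans (unfold (iter n F ∅) q)
          (cong (β q ∨_) (cong₂ _∨_ (branch dn (≤-trans (m≤m+n (nsize l) (nsize r)) h))
                                    (branch rt (≤-trans (m≤n+m (nsize r) (nsize l)) h))))
    where
    -- each child subtree needs one round fewer
    branch : ∀ d → nsize (child d (node l r)) ≤ n →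
      valid T (d ∷ q) ∧ (iter n F ∅ (d ∷ q) ∧ valid T (d ∷ q)) ≡ somewhere β (child d (node l r)) (d ∷ q)
    branch d h' = trans (cong₂ (λ v s → v ∧ (s ∧ v)) (trans (valid≡isNode T (d ∷ q)) (cong isNode e'))
                                                    (rounds n (d ∷ q) (child d (node l r)) e' h'))
                        (somewhere-guard β (child d (node l r)) (d ∷ q))
      where
      e' : subAt T (d ∷ q) ≡ child d (node l r)
      e' = trans (subAt-∷ T d q) (cong (child d) e)

μ-somewhere : ∀ T V B q →
  ⟦ T ⟧ (μ' (wk B ∨' ⟨ ↓ ⟩ x₀ ∨' ⟨ ⇾ ⟩ x₀)) V q ≡ somewhere (⟦ T ⟧ B V) (subAt T q) q
μ-somewhere T V B =
  lfp-down T (⟦ T ⟧ B V) _ (sem-valid T B V) (λ S q → cong (_∨ atChild T S q) (sem-wk T B S V q))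

μ-somewhere₂ : ∀ T V A B q →
  ⟦ T ⟧ (μ' (wk A ∨' wk B ∨' ⟨ ↓ ⟩ x₀ ∨' ⟨ ⇾ ⟩ x₀)) V q ≡ somewhere (⟦ T ⟧ (A ∨' B) V) (subAt T q) q
μ-somewhere₂ T V A B = lfp-down T (⟦ T ⟧ (A ∨' B) V) _ (sem-valid T (A ∨' B) V) unfold
  where
  unfold : ∀ S q → ⟦ T ⟧ (wk A ∨' wk B ∨' ⟨ ↓ ⟩ x₀ ∨' ⟨ ⇾ ⟩ x₀) (ext S V) q ≡ ⟦ T ⟧ (A ∨' B) V q ∨ atChild T S q
  unfold S q = trans (sym (∨-assoc (⟦ T ⟧ (wk A) (ext S V) q) _ _))
                     (cong (_∨ atChild T S q) (cong₂ _∨_ (sem-wk T A S V q) (sem-wk T B S V q)))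

-- Below the root the test r is false, so the disjunct ψ ∧ r of lfp-up vanishes there.
∧false-∨ : ∀ x y → (x ∧ false) ∨ y ≡ y
∧false-∨ true  y = refl
∧false-∨ false y = refl

-- μx. (ψ ∧ r) ∨ ⟨↑⟩x ∨ ⟨←⟩x holds at every valid node iff ψ holds at the root: a node at
-- depth d is reached from the root after d rounds, and |T| rounds exceed every depth.
lfp-up : ∀ T V ψ p → valid T p ≡ true →
  ⟦ T ⟧ (μ' ((wk ψ ∧' root) ∨' ⟨ ↑ ⟩ x₀ ∨' ⟨ ← ⟩ x₀)) V p ≡ ⟦ T ⟧ ψ V []
lfp-up T V ψ p vp = rounds (size T) p vp (valid-depth T p vp)
  where
  F : (Addr → Bool) → Addr → Bool
  F S = ⟦ T ⟧ ((wk ψ ∧' root) ∨' ⟨ ↑ ⟩ x₀ ∨' ⟨ ← ⟩ x₀) (ext S V)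
  rounds : ∀ n q → valid T q ≡ true → length q < n → iter n F ∅ q ≡ ⟦ T ⟧ ψ V []
  rounds (suc n) [] v _ rewrite v =
    trans (∨-identityʳ _) (trans (∧-identityʳ _) (sem-wk T ψ (iter n F ∅) V []))
  rounds (suc n) (dn ∷ q) v (s≤s h) rewrite v | valid-parent T dn q v =
    trans (∧false-∨ (⟦ T ⟧ (wk ψ) (ext (iter n F ∅) V) (dn ∷ q)) _)
          (trans (∨-identityʳ _) (trans (∧-identityʳ _) (rounds n q (valid-parent T dn q v) h)))
  rounds (suc n) (rt ∷ q) v (s≤s h) rewrite v | valid-parent T rt q v =
    trans (∧false-∨ (⟦ T ⟧ (wk ψ) (ext (iter n F ∅) V) (rt ∷ q)) _)
          (trans (∧-identityʳ _) (rounds n q (valid-parent T rt q v) h))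

pairsB : ℕ → ℕ → ℕ → Bool
pairsB a b m = foldr (λ k acc → ((k <ᵇ a) ∧ ((m ∸ k) <ᵇ b)) ∨ acc) false (upTo (suc m))

disjunct⁻ : ∀ (f : ℕ → Bool) ks → foldr (λ k acc → f k ∨ acc) false ks ≡ true →
  Σ ℕ λ k → k ∈ ks × f k ≡ true
disjunct⁻ f (k ∷ ks) e with ∨-true⁻ {f k} e
... | inj₁ fk = k , here refl , fk
... | inj₂ e' with disjunct⁻ f ks e'
...   | k' , k'∈ks , fk' = k' , there k'∈ks , fk'

disjunct⁺ : ∀ (f : ℕ → Bool) {ks k} → k ∈ ks → f k ≡ true → foldr (λ k acc → f k ∨ acc) false ks ≡ true
disjunct⁺ f (here refl) fk = ∨-true⁺ˡ _ fk
disjunct⁺ f {k' ∷ _} (there k∈ks) fk = ∨-true⁺ʳ (f k') (disjunct⁺ f k∈ks fk)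

pairs-sound : ∀ a b m → pairsB a b m ≡ true → suc (suc m) ≤ a + b
pairs-sound a b m e with disjunct⁻ (λ k → (k <ᵇ a) ∧ ((m ∸ k) <ᵇ b)) (upTo (suc m)) e
... | k , k∈ , test =
  ≤-trans (≤-reflexive total)
          (+-mono-≤ (<ᵇ-sound {n = a} (∧-conicalˡ _ _ test)) (<ᵇ-sound {n = b} (∧-conicalʳ (k <ᵇ a) _ test)))
  where
  total : suc (suc m) ≡ suc k + suc (m ∸ k)
  total = sym (trans (cong suc (+-suc k (m ∸ k))) (cong (suc ∘ suc) (m+[n∸m]≡n (≤-pred (∈-upTo⁻ k∈)))))

-- If a = a' + 1 ≤ m + 1 and m + 2 ≤ a + b, the split k₁ = a' works.
pairs-complete : ∀ a' b m → a' ≤ m → suc (suc m) ≤ suc a' + b → pairsB (suc a') b m ≡ true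
pairs-complete a' b m a'≤m h =
  disjunct⁺ (λ k → (k <ᵇ suc a') ∧ ((m ∸ k) <ᵇ b)) (∈-upTo⁺ (s≤s a'≤m))
            (cong₂ _∧_ (<ᵇ-complete (n<1+n a')) (<ᵇ-complete rest))
  where
  rest : m ∸ a' < b
  rest = subst (m ∸ a' <_) (m+n∸m≡n a' b) (∸-monoˡ-< (≤-pred h) a'≤m)

split : ∀ m a b → suc m < a + b → suc m < a ⊎ (suc m < b ⊎ pairsB a b m ≡ true)
split m a b h with suc m <? a | suc m <? b
... | yes ha | _      = inj₁ ha
... | no _   | yes hb = inj₂ (inj₁ hb)
... | no ha  | no hb  with a
...   | zero   = ⊥-elim (hb h)
...   | suc a' = inj₂ (inj₂ (pairs-complete a' b m (≤-pred (≮⇒≥ ha)) h))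

split-eq : ∀ m a b → (suc m <ᵇ a) ∨ ((suc m <ᵇ b) ∨ pairsB a b m) ≡ (suc m <ᵇ a + b)
split-eq m a b = ⇔→≡ (mk⇔ sound complete)
  where
  sound : (suc m <ᵇ a) ∨ ((suc m <ᵇ b) ∨ pairsB a b m) ≡ true → (suc m <ᵇ a + b) ≡ true
  sound e with ∨-true⁻ e
  ... | inj₁ ha = <ᵇ-complete (<-≤-trans (<ᵇ-sound ha) (m≤m+n a b))
  ... | inj₂ e' with ∨-true⁻ e'
  ...   | inj₁ hb = <ᵇ-complete (<-≤-trans (<ᵇ-sound hb) (m≤n+m b a))
  ...   | inj₂ hp = <ᵇ-complete (pairs-sound a b m hp)
  complete : (suc m <ᵇ a + b) ≡ true → (suc m <ᵇ a) ∨ ((suc m <ᵇ b) ∨ pairsB a b m) ≡ true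
  complete e with split m a b (<ᵇ-sound e)
  ... | inj₁ ha        = ∨-true⁺ˡ _ (<ᵇ-complete ha)
  ... | inj₂ (inj₁ hb) = ∨-true⁺ʳ (suc m <ᵇ a) (∨-true⁺ˡ _ (<ᵇ-complete hb))
  ... | inj₂ (inj₂ hp) = ∨-true⁺ʳ (suc m <ᵇ a) (∨-true⁺ʳ (suc m <ᵇ b) hp)

split-eq-zero : ∀ a b → (0 <ᵇ a) ∨ (0 <ᵇ b) ≡ (0 <ᵇ a + b)
split-eq-zero zero    b = refl
split-eq-zero (suc a) b = refl

-- The value of the non-μ disjuncts of C^φ_j at a node with label e whose first-child
-- and next-sibling subtrees hold a and b φ-nodes.
localC : ℕ → Bool → ℕ → ℕ → Bool
localC zero          e a b = e
localC (suc zero)    e a b = (e ∧ ((0 <ᵇ a) ∨ (0 <ᵇ b))) ∨ (not e ∧ ((0 <ᵇ a) ∧ (0 <ᵇ b)))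
localC (suc (suc i)) e a b =
  (e ∧ ((suc i <ᵇ a) ∨ ((suc i <ᵇ b) ∨ pairsB a b i))) ∨ (not e ∧ pairsB a b (suc i))

localC-true : ∀ j a b → localC (suc j) true a b ≡ (j <ᵇ a + b)
localC-true zero    a b = trans (∨-identityʳ _) (split-eq-zero a b)
localC-true (suc i) a b = trans (∨-identityʳ _) (split-eq i a b)

local-count : ∀ j e a b → localC j e a b ∨ ((j <ᵇ a) ∨ (j <ᵇ b)) ≡ (j <ᵇ bit e + (a + b))
local-count zero          true  a b = refl
local-count (suc j)       true  a b =
  trans (cong (_∨ ((suc j <ᵇ a) ∨ (suc j <ᵇ b))) (localC-true j a b))
        (∨-absorb (j <ᵇ a + b) ((suc j <ᵇ a) ∨ (suc j <ᵇ b)) (<ᵇ-complete ∘ one-child))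
  where
  one-child : (suc j <ᵇ a) ∨ (suc j <ᵇ b) ≡ true → j < a + b
  one-child e with ∨-true⁻ e
  ... | inj₁ ha = <-≤-trans (<-trans (n<1+n j) (<ᵇ-sound ha)) (m≤m+n a b)
  ... | inj₂ hb = <-≤-trans (<-trans (n<1+n j) (<ᵇ-sound hb)) (m≤n+m b a)
local-count zero          false a b = split-eq-zero a b
local-count (suc zero)    false a b =
  trans (∨-rotate ((0 <ᵇ a) ∧ (0 <ᵇ b)) (1 <ᵇ a) (1 <ᵇ b))
        (trans (cong (λ x → (1 <ᵇ a) ∨ ((1 <ᵇ b) ∨ x)) (sym (∨-identityʳ _))) (split-eq 0 a b))
local-count (suc (suc i)) false a b =
  trans (∨-rotate (pairsB a b (suc i)) (suc (suc i) <ᵇ a) (suc (suc i) <ᵇ b)) (split-eq (suc i) a b)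

look-++ˡ : ∀ xs ys i → i < length xs → look (xs ++ ys) i ≡ look xs i
look-++ˡ (x ∷ xs) ys zero    _       = refl
look-++ˡ (x ∷ xs) ys (suc i) (s≤s h) = look-++ˡ xs ys i h

look-++-length : ∀ xs c ys → look (xs ++ c ∷ ys) (length xs) ≡ c
look-++-length []       c ys = refl
look-++-length (x ∷ xs) c ys = look-++-length xs c ys

length-Clist : ∀ φ n → length (Clist φ n) ≡ n
length-Clist φ zero    = refl
length-Clist φ (suc n) = trans (length-++ (Clist φ n)) (trans (cong (_+ 1) (length-Clist φ n)) (+-comm n 1))

look-Clist : ∀ φ n i → i < n → look (Clist φ n) i ≡ C φ i
look-Clist φ (suc n) i h with m<1+n⇒m<n∨m≡n h
... | inj₁ i<n  = trans (look-++ˡ (Clist φ n) (C φ n ∷ []) i (subst (i <_) (sym (length-Clist φ n)) i<n))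
                        (look-Clist φ n i i<n)
... | inj₂ refl = trans (cong (look (Clist φ n ++ C φ n ∷ [])) (sym (length-Clist φ n)))
                        (look-++-length (Clist φ n) (C φ n) [])

pairs-sem : ∀ T V cs m q a b →
  (∀ k → k ≤ m → valid T (dn ∷ q) ∧ ⟦ T ⟧ (look cs k) V (dn ∷ q) ≡ (k <ᵇ a)) →
  (∀ k → k ≤ m → valid T (rt ∷ q) ∧ ⟦ T ⟧ (look cs k) V (rt ∷ q) ≡ (k <ᵇ b)) →
  ⟦ T ⟧ (pairs cs m) V q ≡ pairsB a b m
pairs-sem T V cs m q a b test↓ test→ = disjunction (upTo (suc m)) (all-upTo (suc m))
  where
  disjunction : ∀ ks → All (_< suc m) ks →
    ⟦ T ⟧ (foldr (λ k₁ acc → (⟨ ↓ ⟩ look cs k₁ ∧' ⟨ ⇾ ⟩ look cs (m ∸ k₁)) ∨' acc) ⊥' ks) V q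
      ≡ foldr (λ k acc → ((k <ᵇ a) ∧ ((m ∸ k) <ᵇ b)) ∨ acc) false ks
  disjunction []       []       = ∧-inverseʳ (valid T q)
  disjunction (k ∷ ks) (h ∷ hs) =
    cong₂ _∨_ (cong₂ _∧_ (test↓ k (≤-pred h)) (test→ (m ∸ k) (m∸n≤m m k))) (disjunction ks hs)

φ-choice : ∀ e v {x x' y y'} → v ≡ true → x ≡ x' → y ≡ y' →
  (e ∧ x) ∨ ((v ∧ not e) ∧ y) ≡ (e ∧ x') ∨ (not e ∧ y')
φ-choice e v refl refl refl = refl

module Counting (T : Tree) (V : Val) (φ : Form) where

  P : Addr → Bool
  P = ⟦ T ⟧ φ V

  below : Addr → ℕ
  below q = countAt P (subAt T q) q

  Recurrence : ℕ → (Addr → Bool) → Set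
  Recurrence j β = ∀ q l r → subAt T q ≡ node l r →
    β q ≡ localC j (P q) (countAt P l (dn ∷ q)) (countAt P r (rt ∷ q))

  somewhere-count : ∀ j β → Recurrence j β → ∀ q → somewhere β (subAt T q) q ≡ (j <ᵇ below q)
  somewhere-count j β rec q = in-subtree (subAt T q) q refl
    where
    in-subtree : ∀ t q → subAt T q ≡ t → somewhere β t q ≡ (j <ᵇ countAt P t q)
    in-subtree leaf       q e = refl
    in-subtree (node l r) q e =
      trans (cong₂ _∨_ (rec q l r e)
                       (cong₂ _∨_ (in-subtree l (dn ∷ q) (at-child dn)) (in-subtree r (rt ∷ q) (at-child rt))))
            (local-count j (P q) (countAt P l (dn ∷ q)) (countAt P r (rt ∷ q)))
      where
      at-child : ∀ d → subAt T (d ∷ q) ≡ child d (node l r)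
      at-child d = trans (subAt-∷ T d q) (cong (child d) e)

  Counts : ℕ → Set
  Counts i = ∀ q → ⟦ T ⟧ (C φ i) V q ≡ (i <ᵇ below q)

  child-test : ∀ {k} → Counts k → ∀ d q {l r} → subAt T q ≡ node l r →
    valid T (d ∷ q) ∧ ⟦ T ⟧ (C φ k) V (d ∷ q) ≡ (k <ᵇ countAt P (child d (node l r)) (d ∷ q))
  child-test {k} counts-k d q e =
    trans (valid-∧ T (C φ k) V (d ∷ q))
          (trans (counts-k (d ∷ q))
                 (cong (λ t → k <ᵇ countAt P t (d ∷ q)) (trans (subAt-∷ T d q) (cong (child d) e))))

  valid-node : ∀ q {l r} → subAt T q ≡ node l r → valid T q ≡ true
  valid-node q e = trans (valid≡isNode T q) (cong isNode e)

  withφ₁ withoutφ₁ : Form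
  withφ₁    = φ ∧' (⟨ ↓ ⟩ C φ 0 ∨' ⟨ ⇾ ⟩ C φ 0)
  withoutφ₁ = ¬' φ ∧' ⟨ ↓ ⟩ C φ 0 ∧' ⟨ ⇾ ⟩ C φ 0

  withφ₂ withoutφ₂ : ℕ → Form
  withφ₂    i = φ ∧' (⟨ ↓ ⟩ look cs (suc i) ∨' ⟨ ⇾ ⟩ look cs (suc i) ∨' pairs cs i)
    where cs = Clist φ (suc (suc i))
  withoutφ₂ i = ¬' φ ∧' pairs (Clist φ (suc (suc i))) (suc i)

  recurrence₁ : Counts 0 → Recurrence 1 (⟦ T ⟧ (withφ₁ ∨' withoutφ₁) V)
  recurrence₁ counts₀ q l r e =
    φ-choice (P q) (valid T q) (valid-node q e) (cong₂ _∨_ test↓ test→) (cong₂ _∧_ test↓ test→)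
    where
    test↓ : valid T (dn ∷ q) ∧ ⟦ T ⟧ (C φ 0) V (dn ∷ q) ≡ (0 <ᵇ countAt P l (dn ∷ q))
    test↓ = child-test counts₀ dn q e
    test→ : valid T (rt ∷ q) ∧ ⟦ T ⟧ (C φ 0) V (rt ∷ q) ≡ (0 <ᵇ countAt P r (rt ∷ q))
    test→ = child-test counts₀ rt q e

  recurrence₂ : ∀ i → (∀ {k} → k < suc (suc i) → Counts k) →
    Recurrence (suc (suc i)) (⟦ T ⟧ (withφ₂ i ∨' withoutφ₂ i) V)
  recurrence₂ i counts q l r e =
    φ-choice (P q) (valid T q) (valid-node q e)
             (cong₂ _∨_ (test dn ≤-refl) (cong₂ _∨_ (test rt ≤-refl) (pairs-sem′ i (m≤n⇒m≤1+n ≤-refl))))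
             (pairs-sem′ (suc i) ≤-refl)
    where
    cs : List Form
    cs = Clist φ (suc (suc i))
    test : ∀ d {k} → k ≤ suc i →
      valid T (d ∷ q) ∧ ⟦ T ⟧ (look cs k) V (d ∷ q) ≡ (k <ᵇ countAt P (child d (node l r)) (d ∷ q))
    test d {k} k≤ =
      trans (cong (λ ψ → valid T (d ∷ q) ∧ ⟦ T ⟧ ψ V (d ∷ q)) (look-Clist φ (suc (suc i)) k (s≤s k≤)))
            (child-test (counts (s≤s k≤)) d q e)
    a b : ℕ
    a = countAt P l (dn ∷ q)
    b = countAt P r (rt ∷ q)
    pairs-sem′ : ∀ m → m ≤ suc i → ⟦ T ⟧ (pairs cs m) V q ≡ pairsB a b m
    pairs-sem′ m m≤ =
      pairs-sem T V cs m q a b (λ k k≤ → test dn (≤-trans k≤ m≤)) (λ k k≤ → test rt (≤-trans k≤ m≤))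

  -- Strong induction on i: each C^φ_i is a downward fixpoint over a recurrence of smaller ones.
  counts : ∀ i → Counts i
  counts = <-rec Counts step
    where
    step : ∀ j → (∀ {i} → i < j → Counts i) → Counts j
    step zero          _       q = trans (μ-somewhere T V φ q) (somewhere-count 0 P (λ _ _ _ _ → refl) q)
    step (suc zero)    smaller q =
      trans (μ-somewhere₂ T V withφ₁ withoutφ₁ q) (somewhere-count 1 _ (recurrence₁ (smaller (s≤s z≤n))) q)
    step (suc (suc i)) smaller q =
      trans (μ-somewhere₂ T V (withφ₂ i) (withoutφ₂ i) q)
            (somewhere-count (suc (suc i)) _ (recurrence₂ i smaller) q)

lemma6p3 : (T : Tree) (V : Val) (φ : Form) (k : ℕ) (p : Addr) → valid T p ≡ true →
    ⟦ T ⟧ (φ >' k) V p ≡ ⟦ T ⟧ (μ' ((wk (C φ k) ∧' root) ∨' ⟨ ↑ ⟩ x₀ ∨' ⟨ ← ⟩ x₀)) V p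
lemma6p3 T V φ k p vp = begin
  ⟦ T ⟧ (φ >' k) V p                   ≡⟨ cong (_∧ (k <ᵇ count T (⟦ T ⟧ φ V))) vp ⟩
  (k <ᵇ count T (⟦ T ⟧ φ V))           ≡⟨ cong (k <ᵇ_) (count≡countAt T (⟦ T ⟧ φ V)) ⟩
  (k <ᵇ countAt (⟦ T ⟧ φ V) T [])      ≡⟨ sym (Counting.counts T V φ k []) ⟩
  ⟦ T ⟧ (C φ k) V []                   ≡⟨ sym (lfp-up T V (C φ k) p vp) ⟩
  ⟦ T ⟧ (μ' ((wk (C φ k) ∧' root) ∨' ⟨ ↑ ⟩ x₀ ∨' ⟨ ← ⟩ x₀)) V p ∎
  where open ≡-Reasoning
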